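{- Let $\tau$ be a valuation satisfying $\mathsf{Cl}(\Gamma)$. If $C,D\in\mathsf{At}$ with $\tau([C\sqsubseteq D])=0$, then $\sigma_\tau(C)\not\sqsubseteq\sigma_\tau(D)$.
   Context: $\mathcal{EL}$ concept terms are built from concept names and role names using $C\sqcap D$, $\exists r.C$ and $\top$; $C\sqsubseteq D$ means $C^{\mathcal I}\subseteq D^{\mathcal I}$ in every interpretation. Concept names are split into variables $N_v$ and constants $N_c$. $\Gamma$ is a flat disunification problem: subsumptions $C_1\sqcap\dots\sqcap C_n\sqsubseteq^? D$ of flat atoms (concept names or $\exists r.A$, $A$ a concept name) and dissubsumptions, all of the form $X\not\sqsubseteq^? Y$ with variables $X,Y$; $N_v,N_c,N_R$ are exactly the variables, constants and roles occurring in $\Gamma$. $\mathsf{At}$ = atoms occurring as subterms of $\Gamma$, $\mathsf{At_{nv}}=\mathsf{At}\setminus N_v$. $\mathsf{Cl}(\Gamma)$ is the clause set over propositional variables $[C\sqsubseteq D]$ ($C,D\in\mathsf{At}$), $[X>Y]$ ($X,Y\in N_v$), $p_{C,X,D}$ ($C\in\mathsf{At}$, $X\in N_v$, $D\in\mathsf{At_{nv}}$): (Ia) for each $C_1\sqcap\dots\sqcap C_n\sqsubseteq^? D$ in $\Gamma$ with $D\in\mathsf{At_{nv}}$: $[C_1\sqsubseteq D]\lor\dots\lor[C_n\sqsubseteq D]$; (Ib) for each $C_1\sqcap\dots\sqcap C_n\sqsubseteq^? X$ in $\Gamma$, $X\in N_v$, and $E\in\mathsf{At_{nv}}$: $[X\sqsubseteq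 E]\to[C_1\sqsubseteq E]\lor\dots\lor[C_n\sqsubseteq E]$; (Ic) for each $X\not\sqsubseteq^? Y$ in $\Gamma$: $\lnot[X\sqsubseteq Y]$; (IIa) $[A\sqsubseteq A]$ for $A\in N_c$; (IIb) $\lnot[A\sqsubseteq B]$ for distinct $A,B\in N_c$; (IIc) $\lnot[\exists r.A\sqsubseteq\exists s.B]$ for $\exists r.A,\exists s.B\in\mathsf{At_{nv}}$, $r\ne s$; (IId) $\lnot[A\sqsubseteq\exists r.B]$ and $\lnot[\exists r.B\sqsubseteq A]$ for $A\in N_c$, $\exists r.B\in\mathsf{At_{nv}}$; (IIe) $[\exists r.A\sqsubseteq\exists r.B]\to[A\sqsubseteq B]$ and $[A\sqsubseteq B]\to[\exists r.A\sqsubseteq\exists r.B]$; (III) $[C_1\sqsubseteq C_2]\land[C_2\sqsubseteq C_3]\to[C_1\sqsubseteq C_3]$ for $C_1,C_2,C_3\in\mathsf{At}$; (IV) for $C\in\mathsf{At}$, $X\in N_v$: $[C\sqsubseteq X]\lor\bigvee_{D\in\mathsf{At_{nv}}}p_{C,X,D}$, and for each $D\in\mathsf{At_{nv}}$: $p_{C,X,D}\to[X\sqsubseteq D]$ and $\lnot(p_{C,X,D}\land[C\sqsubseteq D])$; (Va) $\lnot[X>X]$; (Vb) $[X>Y]\land[Y>Z]\to[X>Z]$; (Vc) $[X\sqsubseteq\exists r.Y]\to[X>Y]$ for $X,Y\in N_v$ with $\exists r.Y\in\mathsf{At}$. For a satisfying $\tau$, let $S^\tau_X:=\{D\in\mathsf{At_{nv}}\mid\tau([X\sqsubseteq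 D])=1\}$; $>_{S^\tau}$ (transitive closure of $\{(X,Y)\mid Y\text{ occurs in an atom of }S^\tau_X\}$) is irreflexive, so $\sigma_\tau$ is defined inductively by $\sigma_\tau(X):=\sigma_\tau(D_1)\sqcap\dots\sqcap\sigma_\tau(D_k)$ for $S^\tau_X=\{D_1,\dots,D_k\}$ ($\top$ if empty), ground atoms being unchanged. -}

module Defs where

open import Data.Nat using (ℕ)
open import Data.Bool using (Bool; true; false)
open import Data.List using (List; []; _∷_; _++_; map; concatMap)
open import Data.List.Membership.Propositional using (_∈_)
open import Data.List.Relation.Unary.Any using (Any)
open import Data.Product using (Σ; _×_; _,_)
open import Data.Empty using (⊥)
open import Data.Sum using (_⊎_)
open import Data.Unit using (⊤)
open import Relation.Binary.PropositionalEquality using (_≡_; _≢_)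
open import Relation.Nullary using (¬_)
open import Function.Bundles using (_⇔_)

-- Concept names are split into variables and constants (indexed by ℕ);
-- role names are natural numbers.
data Name : Set where
  var : ℕ → Name
  con : ℕ → Name

data Concept : Set where
  ⊤ᶜ  : Concept
  cn  : Name → Concept
  _⊓_ : Concept → Concept → Concept
  ∃ᶜ  : ℕ → Concept → Concept

record Interp : Set₁ where
  field
    Δ    : Set
    conI : Name → Δ → Set
    rolI : ℕ → Δ → Δ → Set
open Interp public

⟦_⟧ : Concept → (I : Interp) → Δ I → Set
⟦ ⊤ᶜ ⟧ I x = ⊤
⟦ cn A ⟧ I x = conI I A x
⟦ C ⊓ D ⟧ I x = ⟦ C ⟧ I x × ⟦ D ⟧ I x
⟦ ∃ᶜ r C ⟧ I x = Σ (Δ I) λ y → rolI I r x y × ⟦ C ⟧ I y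

_⊑_ : Concept → Concept → Set₁
C ⊑ D = (I : Interp) (x : Δ I) → ⟦ C ⟧ I x → ⟦ D ⟧ I x

data FAtom : Set where
  nm : Name → FAtom
  ex : ℕ → Name → FAtom

-- C₁ ⊓ … ⊓ Cₙ ⊑? D
record Subsumption : Set where
  constructor _⊑?_
  field
    lhs : List FAtom
    rhs : FAtom
open Subsumption public

-- subsumptions, and dissubsumptions X ⋢? Y (pairs of variables)
record Problem : Set where
  field
    subs    : List Subsumption
    dissubs : List (ℕ × ℕ)
open Problem public

subAtoms : FAtom → List FAtom
subAtoms (nm A)   = nm A ∷ []
subAtoms (ex r A) = ex r A ∷ nm A ∷ []

atomsSub : Subsumption → List FAtom
atomsSub s = concatMap subAtoms (lhs s ++ (rhs s ∷ []))

atomsDis : ℕ × ℕ → List FAtom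
atomsDis (X , Y) = nm (var X) ∷ nm (var Y) ∷ []

-- list enumerating At (possibly with repetitions)
atoms : Problem → List FAtom
atoms Γ = concatMap atomsSub (subs Γ) ++ concatMap atomsDis (dissubs Γ)

At : Problem → FAtom → Set
At Γ a = a ∈ atoms Γ

NotVar : FAtom → Set
NotVar (nm (var _)) = ⊥
NotVar _ = ⊤

AtNv : Problem → FAtom → Set
AtNv Γ a = At Γ a × NotVar a

Nv : Problem → ℕ → Set
Nv Γ X = At Γ (nm (var X))

Nc : Problem → ℕ → Set
Nc Γ A = At Γ (nm (con A))

record Valuation : Set where
  field
    sub : FAtom → FAtom → Bool        -- [C ⊑ D]
    gt  : ℕ → ℕ → Bool                -- [X > Y]
    p   : FAtom → ℕ → FAtom → Bool
open Valuation public

v : ℕ → FAtom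
v X = nm (var X)

c : ℕ → FAtom
c A = nm (con A)

record Satisfies (Γ : Problem) (τ : Valuation) : Set where
  field
    Ia  : ∀ s → s ∈ subs Γ → AtNv Γ (rhs s) →
          Any (λ C → sub τ C (rhs s) ≡ true) (lhs s)
    Ib  : ∀ s → s ∈ subs Γ → ∀ X → rhs s ≡ v X → ∀ E → AtNv Γ E →
          sub τ (v X) E ≡ true → Any (λ C → sub τ C E ≡ true) (lhs s)
    Ic  : ∀ X Y → (X , Y) ∈ dissubs Γ → sub τ (v X) (v Y) ≡ false
    IIa : ∀ A → Nc Γ A → sub τ (c A) (c A) ≡ true
    IIb : ∀ A B → Nc Γ A → Nc Γ B → A ≢ B → sub τ (c A) (c B) ≡ false
    IIc : ∀ r A s B → AtNv Γ (ex r A) → AtNv Γ (ex s B) → r ≢ s →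
          sub τ (ex r A) (ex s B) ≡ false
    IId₁ : ∀ A r B → Nc Γ A → AtNv Γ (ex r B) → sub τ (c A) (ex r B) ≡ false
    IId₂ : ∀ A r B → Nc Γ A → AtNv Γ (ex r B) → sub τ (ex r B) (c A) ≡ false
    IIe₁ : ∀ r A B → AtNv Γ (ex r A) → AtNv Γ (ex r B) →
           sub τ (ex r A) (ex r B) ≡ true → sub τ (nm A) (nm B) ≡ true
    IIe₂ : ∀ r A B → AtNv Γ (ex r A) → AtNv Γ (ex r B) →
           sub τ (nm A) (nm B) ≡ true → sub τ (ex r A) (ex r B) ≡ true
    III : ∀ C₁ C₂ C₃ → At Γ C₁ → At Γ C₂ → At Γ C₃ →
          sub τ C₁ C₂ ≡ true → sub τ C₂ C₃ ≡ true → sub τ C₁ C₃ ≡ true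
    IV₁ : ∀ C X → At Γ C → Nv Γ X →
          sub τ C (v X) ≡ true ⊎ Σ FAtom (λ D → AtNv Γ D × p τ C X D ≡ true)
    IV₂ : ∀ C X D → At Γ C → Nv Γ X → AtNv Γ D →
          p τ C X D ≡ true → sub τ (v X) D ≡ true
    IV₃ : ∀ C X D → At Γ C → Nv Γ X → AtNv Γ D →
          ¬ (p τ C X D ≡ true × sub τ C D ≡ true)
    Va  : ∀ X → Nv Γ X → gt τ X X ≡ false
    Vb  : ∀ X Y Z → Nv Γ X → Nv Γ Y → Nv Γ Z →
          gt τ X Y ≡ true → gt τ Y Z ≡ true → gt τ X Z ≡ true
    Vc  : ∀ X r Y → Nv Γ X → Nv Γ Y → At Γ (ex r (var Y)) →
          sub τ (v X) (ex r (var Y)) ≡ true → gt τ X Y ≡ true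

Subst : Set
Subst = ℕ → Concept

applyName : Subst → Name → Concept
applyName σ (var X) = σ X
applyName σ (con A) = cn (con A)

applyAtom : Subst → FAtom → Concept
applyAtom σ (nm A)   = applyName σ A
applyAtom σ (ex r A) = ∃ᶜ r (applyName σ A)

conj : List Concept → Concept
conj [] = ⊤ᶜ
conj (C ∷ []) = C
conj (C ∷ Cs@(_ ∷ _)) = C ⊓ conj Cs

-- σ is σ_τ: for every X ∈ N_v, σ(X) = σ(D₁) ⊓ … ⊓ σ(Dₖ) where
-- D₁,…,Dₖ enumerates S^τ_X = {D ∈ At_nv | τ([X ⊑ D]) = 1}
-- (ground atoms are left unchanged by applyAtom)
IsSigmaTau : Problem → Valuation → Subst → Set
IsSigmaTau Γ τ σ =
  ∀ X → Nv Γ X → Σ (List FAtom) λ Ds →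
    (∀ D → (D ∈ Ds) ⇔ (AtNv Γ D × sub τ (v X) D ≡ true)) ×
    σ X ≡ conj (map (applyAtom σ) Ds)

-- The countermodel for σ(C) ⋢ σ(D) is built by recursion on the size of σ(C) and σ(D).
-- Every σ(C) is the conjunction of the σ-images of the non-variable atoms E with
-- τ([C ⊑ E]) = 1.  If D is a variable, clause (IV) supplies such an atom D' of σ(D)
-- with τ([C ⊑ D']) = 0, reducing to the case of a non-variable D.  If D is a
-- constant A, no conjunct of σ(C) is A, and a point satisfying every other name
-- and every existential refutes A.  If D = ∃r.B, then for every conjunct ∃r.A of
-- σ(C), transitivity (III) and (IIe) give τ([A ⊑ B]) = 0, so recursively
-- σ(A) ⋢ σ(B); hanging the countermodels for these below a fresh root refutes ∃r.σ(B).
module Submission where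

open import Defs
open import Data.Bool using (Bool; true; false)
open import Data.Bool.Properties using (¬-not; not-¬)
open import Data.Empty using (⊥-elim)
open import Data.List using (List; []; _∷_; _++_; map; concatMap)
open import Data.List.Membership.Propositional using (_∈_; _∉_)
open import Data.List.Membership.Propositional.Properties
  using (∈-map⁺; ∈-map⁻; ∈-concatMap⁺; ∈-concatMap⁻; ∈-++⁺ˡ; ∈-++⁻)
open import Data.List.Relation.Unary.Any using (here; there)
import Data.List.Relation.Unary.Any as Any
open import Data.Nat using (ℕ; suc; _+_; _≤_; _<_)
open import Data.Nat.Properties
  using ( _≟_; ≤-refl; ≤-trans; m≤m+n; m≤n+m; n≤1+n; n<1+n; m<1+n⇒m≤n
        ; +-mono-<; +-monoʳ-≤; ≤-<-trans; <-≤-trans )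
open import Data.Product using (Σ; _×_; _,_; proj₁; proj₂)
open import Data.Sum using (inj₁; inj₂)
open import Data.Unit using (⊤; tt)
open import Function using (_∘_)
open import Function.Bundles using (Equivalence)
open import Relation.Binary.PropositionalEquality using (_≡_; _≢_; refl; sym; subst)
open import Relation.Nullary using (¬_; yes; no)

size : Concept → ℕ
size ⊤ᶜ       = 1
size (cn _)   = 1
size (C ⊓ D)  = suc (size C + size D)
size (∃ᶜ _ C) = suc (size C)

conj-intro : ∀ {I x} Ks → (∀ {K} → K ∈ Ks → ⟦ K ⟧ I x) → ⟦ conj Ks ⟧ I x
conj-intro []               h = tt
conj-intro (K ∷ [])         h = h (here refl)
conj-intro (K ∷ Ks@(_ ∷ _)) h = h (here refl) , conj-intro Ks (h ∘ there)

conj-elim : ∀ {K Ks} → K ∈ Ks → conj Ks ⊑ K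
conj-elim {Ks = _ ∷ []}    (here refl) I x h       = h
conj-elim {Ks = _ ∷ []}    (there ())
conj-elim {Ks = _ ∷ _ ∷ _} (here refl) I x (h , _) = h
conj-elim {Ks = _ ∷ _ ∷ _} (there K∈)  I x (_ , h) = conj-elim K∈ I x h

size-∈-conj : ∀ {K Ks} → K ∈ Ks → size K ≤ size (conj Ks)
size-∈-conj {Ks = _ ∷ []}    (here refl) = ≤-refl
size-∈-conj {Ks = _ ∷ []}    (there ())
size-∈-conj {Ks = K ∷ _ ∷ _} (here refl) = ≤-trans (m≤m+n (size K) _) (n≤1+n _)
size-∈-conj {Ks = K ∷ _ ∷ _} (there K∈)  =
  ≤-trans (size-∈-conj K∈) (≤-trans (m≤n+m _ (size K)) (n≤1+n _))

record Countermodel (K L : Concept) : Set₁ where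
  constructor countermodel
  field
    I         : Interp
    x         : Δ I
    satisfies : ⟦ K ⟧ I x
    refutes   : ¬ ⟦ L ⟧ I x

Countermodel⇒⋢ : ∀ {K L} → Countermodel K L → ¬ (K ⊑ L)
Countermodel⇒⋢ (countermodel I x k ¬l) K⊑L = ¬l (K⊑L I x k)

Countermodel-⊑ʳ : ∀ {K L L′} → L ⊑ L′ → Countermodel K L′ → Countermodel K L
Countermodel-⊑ʳ L⊑L′ (countermodel I x k ¬l′) = countermodel I x k (¬l′ ∘ L⊑L′ I x)

saturated : ∀ (I : Interp) t → (∀ N → conI I N t) → (∀ r → rolI I r t t) → ∀ K → ⟦ K ⟧ I t
saturated I t names loops ⊤ᶜ       = tt
saturated I t names loops (cn N)   = names N
saturated I t names loops (K ⊓ L)  = saturated I t names loops K , saturated I t names loops L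
saturated I t names loops (∃ᶜ r K) = t , loops r , saturated I t names loops K

data Flat : Concept → Set where
  name   : ∀ N → Flat (cn N)
  exists : ∀ r K → Flat (∃ᶜ r K)

module NameCountermodel (N : Name) where

  data Point : Set where
    top root : Point

  names : Name → Point → Set
  names N′ top  = ⊤
  names N′ root = N′ ≢ N

  M : Interp
  M = record { Δ = Point ; conI = names ; rolI = λ _ _ y → y ≡ top }

  root-flat : ∀ {K} → Flat K → K ≢ cn N → ⟦ K ⟧ M root
  root-flat (name N′)    K≢N = λ { refl → K≢N refl }
  root-flat (exists r K) _   = top , refl , saturated M top (λ _ → tt) (λ _ → refl) K

conj-countermodel-name : ∀ N Ks → (∀ {K} → K ∈ Ks → Flat K) → cn N ∉ Ks →
                         Countermodel (conj Ks) (cn N)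
conj-countermodel-name N Ks flat N∉Ks =
  countermodel M root (conj-intro Ks λ K∈ → root-flat (flat K∈) λ { refl → N∉Ks K∈ })
                      (λ N≢N → N≢N refl)
  where open NameCountermodel N

module ∃Countermodel (r : ℕ) {Ix : Set} (I : Ix → Interp) (pt : ∀ i → Δ (I i)) where

  data Point : Set where
    top root : Point
    child    : ∀ i → Δ (I i) → Point

  names : Name → Point → Set
  names N (child i y) = conI (I i) N y
  names N _           = ⊤

  data Edge : ℕ → Point → Point → Set where
    top-loop   : ∀ {s} → Edge s top top
    root-top   : ∀ {s} → s ≢ r → Edge s root top
    root-child : ∀ i → Edge r root (child i (pt i))
    inside     : ∀ {s i y z} → rolI (I i) s y z → Edge s (child i y) (child i z)

  M : Interp
  M = record { Δ = Point ; conI = names ; rolI = Edge }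

  embed : ∀ K {i y} → ⟦ K ⟧ (I i) y → ⟦ K ⟧ M (child i y)
  embed ⊤ᶜ       k           = tt
  embed (cn N)   k           = k
  embed (K ⊓ L)  (k , l)     = embed K k , embed L l
  embed (∃ᶜ s K) (z , e , k)   = child _ z , inside e , embed K k

  restrict : ∀ K {i y} → ⟦ K ⟧ M (child i y) → ⟦ K ⟧ (I i) y
  restrict ⊤ᶜ       k                  = tt
  restrict (cn N)   k                  = k
  restrict (K ⊓ L)  (k , l)            = restrict K k , restrict L l
  restrict (∃ᶜ s K) (_ , inside e , k) = _ , e , restrict K k

  top-saturated : ∀ K → ⟦ K ⟧ M top
  top-saturated = saturated M top (λ _ → tt) (λ _ → top-loop)

conj-countermodel-∃ : ∀ r L Ks → (∀ {K} → K ∈ Ks → Flat K) →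
                      (∀ {K} → ∃ᶜ r K ∈ Ks → Countermodel K L) →
                      Countermodel (conj Ks) (∃ᶜ r L)
conj-countermodel-∃ r L Ks flat weak =
  countermodel M root (conj-intro Ks λ K∈ → root-flat (flat K∈) K∈) root-refutes
  where
  Ix : Set
  Ix = Σ Concept λ K → ∃ᶜ r K ∈ Ks

  weak-at : (i : Ix) → Countermodel (proj₁ i) L
  weak-at (_ , K∈) = weak K∈

  open ∃Countermodel r (Countermodel.I ∘ weak-at) (Countermodel.x ∘ weak-at)

  root-flat : ∀ {K} → Flat K → K ∈ Ks → ⟦ K ⟧ M root
  root-flat (name N)     _  = tt
  root-flat (exists s K) K∈ with s ≟ r
  ... | no s≢r   = top , root-top s≢r , top-saturated K
  ... | yes refl = _ , root-child (K , K∈) , embed K (Countermodel.satisfies (weak K∈))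

  root-refutes : ¬ ⟦ ∃ᶜ r L ⟧ M root
  root-refutes (_ , root-top r≢r , _)        = r≢r refl
  root-refutes (_ , root-child (_ , K∈) , l) = Countermodel.refutes (weak K∈) (restrict L l)

applyAtom-flat : ∀ σ {E} → NotVar E → Flat (applyAtom σ E)
applyAtom-flat σ {nm (var _)} ()
applyAtom-flat σ {nm (con A)} _ = name (con A)
applyAtom-flat σ {ex r A}     _ = exists r _

applyAtom-cn⁻ : ∀ σ {E N} → NotVar E → applyAtom σ E ≡ cn N → E ≡ nm N
applyAtom-cn⁻ σ {nm (var _)} ()
applyAtom-cn⁻ σ {nm (con A)} _ refl = refl
applyAtom-cn⁻ σ {ex r A}     _ ()

applyAtom-∃⁻ : ∀ σ {E r K} → NotVar E → applyAtom σ E ≡ ∃ᶜ r K →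
               Σ Name λ A → E ≡ ex r A × applyName σ A ≡ K
applyAtom-∃⁻ σ {nm (var _)} ()
applyAtom-∃⁻ σ {nm (con A)} _ ()
applyAtom-∃⁻ σ {ex r A}     _ refl = A , refl , refl

∈-concatMap-mono : ∀ {X Y : Set} {f : X → List Y} {a b} xs →
                   (∀ {x} → a ∈ f x → b ∈ f x) → a ∈ concatMap f xs → b ∈ concatMap f xs
∈-concatMap-mono {f = f} xs a⇒b = ∈-concatMap⁺ f {xs} ∘ Any.map a⇒b ∘ ∈-concatMap⁻ f {xs}

At-∃⇒At-name : ∀ Γ {r A} → At Γ (ex r A) → At Γ (nm A)
At-∃⇒At-name Γ ∃∈ with ∈-++⁻ (concatMap atomsSub (subs Γ)) ∃∈
... | inj₁ ∃∈subs =
  ∈-++⁺ˡ (∈-concatMap-mono (subs Γ) (λ {s} → ∈-concatMap-mono (lhs s ++ rhs s ∷ []) subAtoms-filler) ∃∈subs)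
  where
  subAtoms-filler : ∀ {r A E} → ex r A ∈ subAtoms E → nm A ∈ subAtoms E
  subAtoms-filler {E = nm _}   (here ())
  subAtoms-filler {E = nm _}   (there ())
  subAtoms-filler {E = ex _ _} (here refl) = there (here refl)
  subAtoms-filler {E = ex _ _} (there (here ()))
  subAtoms-filler {E = ex _ _} (there (there ()))
... | inj₂ ∃∈dis = ⊥-elim (no-∃ (dissubs Γ) ∃∈dis)
  where
  no-∃ : ∀ {r A} ds → ex r A ∉ concatMap atomsDis ds
  no-∃ (_ ∷ ds) (here ())
  no-∃ (_ ∷ ds) (there (here ()))
  no-∃ (_ ∷ ds) (there (there ∃∈)) = no-∃ ds ∃∈

false-contrapositive : ∀ {a b : Bool} → (a ≡ true → b ≡ true) → b ≡ false → a ≡ false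
false-contrapositive a⇒b b≡false = ¬-not (not-¬ b≡false ∘ a⇒b)

module _ {Γ : Problem} {τ : Valuation} {σ : Subst} (sat : Satisfies Γ τ) (στ : IsSigmaTau Γ τ σ) where
  open Satisfies sat

  σa : FAtom → Concept
  σa = applyAtom σ

  weight : FAtom → FAtom → ℕ
  weight C D = size (σa C) + size (σa D)

  sub-refl-name : ∀ {A} → At Γ (nm A) → sub τ (nm A) (nm A) ≡ true
  sub-refl-name {con A} A∈ = IIa A A∈
  sub-refl-name {var X} X∈ with IV₁ (v X) X X∈ X∈
  ... | inj₁ X⊑X          = X⊑X
  ... | inj₂ (D , D∈ , p) = ⊥-elim (IV₃ (v X) X D X∈ X∈ D∈ (p , IV₂ (v X) X D X∈ X∈ D∈ p))

  separating-atom : ∀ {C Y} → At Γ C → Nv Γ Y → sub τ C (v Y) ≡ false →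
                    Σ FAtom λ D → AtNv Γ D × sub τ (v Y) D ≡ true × sub τ C D ≡ false
  separating-atom {C} {Y} C∈ Y∈ C⋢Y with IV₁ C Y C∈ Y∈
  ... | inj₁ C⊑Y          = ⊥-elim (not-¬ C⋢Y C⊑Y)
  ... | inj₂ (D , D∈ , p) =
    D , D∈ , IV₂ C Y D C∈ Y∈ D∈ p , ¬-not λ C⊑D → IV₃ C Y D C∈ Y∈ D∈ (p , C⊑D)

  record Decomposition (C : FAtom) : Set where
    field
      conjuncts : List FAtom
      nonvar    : ∀ {E} → E ∈ conjuncts → AtNv Γ E
      below     : ∀ {E} → E ∈ conjuncts → sub τ C E ≡ true
      unfold    : σa C ≡ conj (map σa conjuncts)

    conjunct-flat : ∀ {K} → K ∈ map σa conjuncts → Flat K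
    conjunct-flat K∈ with ∈-map⁻ σa K∈
    ... | E , E∈ , refl = applyAtom-flat σ (proj₂ (nonvar E∈))

    conjunct-size : ∀ {E} → E ∈ conjuncts → size (σa E) ≤ size (σa C)
    conjunct-size {E} E∈ = subst (λ K → size (σa E) ≤ size K) (sym unfold) (size-∈-conj (∈-map⁺ σa E∈))

  open Decomposition

  singleton-decomposition : ∀ {C} → AtNv Γ C → sub τ C C ≡ true → Decomposition C
  singleton-decomposition {C} C∈ C⊑C = record
    { conjuncts = C ∷ []
    ; nonvar    = λ { (here refl) → C∈ }
    ; below     = λ { (here refl) → C⊑C }
    ; unfold    = refl
    }

  decompose : ∀ {C} → At Γ C → Decomposition C
  decompose {nm (var X)} X∈ =
    let (Ds , S-X , σX) = στ X X∈ in record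
      { conjuncts = Ds
      ; nonvar    = proj₁ ∘ Equivalence.to (S-X _)
      ; below     = proj₂ ∘ Equivalence.to (S-X _)
      ; unfold    = σX
      }
  decompose {nm (con A)} A∈ = singleton-decomposition (A∈ , tt) (IIa A A∈)
  decompose {ex r A}     E∈ =
    singleton-decomposition (E∈ , tt)
      (IIe₂ r A A (E∈ , tt) (E∈ , tt) (sub-refl-name (At-∃⇒At-name Γ E∈)))

  var-conjunct : ∀ {Y D} (Y∈ : Nv Γ Y) → AtNv Γ D → sub τ (v Y) D ≡ true → D ∈ conjuncts (decompose Y∈)
  var-conjunct {Y} Y∈ D∈ Y⊑D = Equivalence.from (proj₁ (proj₂ (στ Y Y∈)) _) (D∈ , Y⊑D)

  σ-var-⊑ : ∀ {Y D} → Nv Γ Y → AtNv Γ D → sub τ (v Y) D ≡ true → σ Y ⊑ σa D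
  σ-var-⊑ {D = D} Y∈ D∈ Y⊑D =
    subst (_⊑ σa D) (sym (unfold (decompose Y∈))) (conj-elim (∈-map⁺ σa (var-conjunct Y∈ D∈ Y⊑D)))

  sub-false-below : ∀ {C E D} → At Γ C → At Γ E → At Γ D →
                    sub τ C E ≡ true → sub τ C D ≡ false → sub τ E D ≡ false
  sub-false-below C∈ E∈ D∈ C⊑E = false-contrapositive (III _ _ _ C∈ E∈ D∈ C⊑E)

  sub-false-∃⁻ : ∀ {r A B} → At Γ (ex r A) → At Γ (ex r B) →
                 sub τ (ex r A) (ex r B) ≡ false → sub τ (nm A) (nm B) ≡ false
  sub-false-∃⁻ A∈ B∈ = false-contrapositive (IIe₂ _ _ _ (A∈ , tt) (B∈ , tt))

  ∃-conjunct-sub-false : ∀ {C r A B} (C∈ : At Γ C) → ex r A ∈ conjuncts (decompose C∈) →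
                         At Γ (ex r B) → sub τ C (ex r B) ≡ false → sub τ (nm A) (nm B) ≡ false
  ∃-conjunct-sub-false C∈ E∈ B∈ =
    sub-false-∃⁻ E∈At B∈ ∘ sub-false-below C∈ E∈At B∈ (below (decompose C∈) E∈)
    where E∈At = proj₁ (nonvar (decompose C∈) E∈)

  σ-countermodel-con : ∀ {C A} → At Γ C → sub τ C (c A) ≡ false → Countermodel (σa C) (σa (c A))
  σ-countermodel-con {C} {A} C∈ C⋢A =
    subst (λ K → Countermodel K _) (sym (unfold d))
          (conj-countermodel-name (con A) _ (conjunct-flat d) A∉)
    where
    d = decompose C∈
    A∉ : cn (con A) ∉ map σa (conjuncts d)
    A∉ A∈ with ∈-map⁻ σa A∈
    ... | E , E∈ , A≡E with applyAtom-cn⁻ σ (proj₂ (nonvar d E∈)) (sym A≡E)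
    ... | refl = not-¬ C⋢A (below d E∈)

  σ-countermodel-∃ : ∀ {C r B} (C∈ : At Γ C) →
                     (∀ {A} → ex r A ∈ conjuncts (decompose C∈) →
                              Countermodel (applyName σ A) (applyName σ B)) →
                     Countermodel (σa C) (σa (ex r B))
  σ-countermodel-∃ {r = r} C∈ weak =
    subst (λ K → Countermodel K _) (sym (unfold d)) (conj-countermodel-∃ r _ _ (conjunct-flat d) weak′)
    where
    d = decompose C∈
    weak′ : ∀ {K} → ∃ᶜ r K ∈ map σa (conjuncts d) → Countermodel K _
    weak′ K∈ with ∈-map⁻ σa K∈
    ... | E , E∈ , K≡E with applyAtom-∃⁻ σ (proj₂ (nonvar d E∈)) (sym K≡E)
    ... | _ , refl , refl = weak E∈

  mutual
    σ-countermodel : ∀ n {C D} → At Γ C → At Γ D → sub τ C D ≡ false → weight C D < n →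
                     Countermodel (σa C) (σa D)
    σ-countermodel n {D = nm (var Y)} C∈ Y∈ C⋢Y w<n =
      let (D , D∈ , Y⊑D , C⋢D) = separating-atom C∈ Y∈ C⋢Y
          D-smaller = conjunct-size (decompose Y∈) (var-conjunct Y∈ D∈ Y⊑D)
      in Countermodel-⊑ʳ (σ-var-⊑ Y∈ D∈ Y⊑D)
           (σ-countermodel-nonvar n C∈ D∈ C⋢D (≤-<-trans (+-monoʳ-≤ _ D-smaller) w<n))
    σ-countermodel n {D = nm (con _)} C∈ D∈ = σ-countermodel-nonvar n C∈ (D∈ , tt)
    σ-countermodel n {D = ex _ _}     C∈ D∈ = σ-countermodel-nonvar n C∈ (D∈ , tt)

    σ-countermodel-nonvar : ∀ n {C D} → At Γ C → AtNv Γ D → sub τ C D ≡ false → weight C D < n →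
                            Countermodel (σa C) (σa D)
    σ-countermodel-nonvar n       {D = nm (var _)} C∈ (_ , ())
    σ-countermodel-nonvar n       {D = nm (con _)} C∈ _ C⋢A _ = σ-countermodel-con C∈ C⋢A
    σ-countermodel-nonvar (suc n) {D = ex r B} C∈ (B∈ , _) C⋢B w<n =
      σ-countermodel-∃ {B = B} C∈ λ E∈ →
        σ-countermodel n (At-∃⇒At-name Γ (proj₁ (nonvar (decompose C∈) E∈))) (At-∃⇒At-name Γ B∈)
          (∃-conjunct-sub-false C∈ E∈ B∈ C⋢B)
          (<-≤-trans (+-mono-< (conjunct-size (decompose C∈) E∈) (n<1+n _)) (m<1+n⇒m≤n w<n))

lemma6p4 : (Γ : Problem) (τ : Valuation) (σ : Subst) →
           Satisfies Γ τ → IsSigmaTau Γ τ σ →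
           (C D : FAtom) → At Γ C → At Γ D → sub τ C D ≡ false →
           ¬ (applyAtom σ C ⊑ applyAtom σ D)
lemma6p4 Γ τ σ sat στ C D C∈ D∈ C⋢D = Countermodel⇒⋢ (σ-countermodel sat στ _ C∈ D∈ C⋢D (n<1+n _))
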